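{- Let $\mathbf G$ and $\mathbf H$ be abelian groups and $S\subseteq\{0,\bot,\top,!\}$. (i) Every group embedding $\alpha:\mathbf G\to\mathbf H$ extends uniquely to an embedding $\beta:\mathrm R^S(\mathbf G)\to\mathrm R^S(\mathbf H)$. (ii) Every embedding $\beta:\mathrm R^S(\mathbf G)\to\mathrm R^S(\mathbf H)$ restricts to a group embedding $\alpha:\mathbf G\to\mathbf H$.
   Context: For an abelian group $\mathbf G=\langle G,\cdot,{}^{ -1},1\rangle$, let $\bot,\top\notin G$ be new elements and order $G\cup\{\bot,\top\}$ by $\bot<a<\top$ for all $a\in G$, with distinct elements of $G$ incomparable. Extend the multiplication of $\mathbf G$ by $a\cdot\top=\top\cdot a=\top$ for $a\in G\cup\{\top\}$ and $b\cdot\bot=\bot\cdot b=\bot$ for all $b$, let $a\to c=\max\{b:ab\le c\}$, $0:=1$, $!a:=a\wedge1$. For $S\subseteq\{0,\bot,\top,!\}$, $\mathrm R^S(\mathbf G)$ is the reduct of $\langle G\cup\{\bot,\top\},\wedge,\vee,\cdot,\to,1,0,\bot,\top,!\rangle$ to the language $\{\wedge,\vee,\cdot,\to,1\}\cup S$. -}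

module Defs where

open import Level using (Level; _⊔_; Lift)
open import Data.Product using (Σ; _×_; _,_)
open import Data.Bool using (Bool; true)
open import Relation.Binary.PropositionalEquality using (_≡_)
open import Relation.Nullary using (¬_)
open import Algebra.Bundles using (AbelianGroup)
import Algebra.Morphism.Structures as MS

data Ext {c} (A : Set c) : Set c where
  bot : Ext A
  top : Ext A
  el  : A → Ext A

module R {c ℓ} (G : AbelianGroup c ℓ) where
  open AbelianGroup G renaming (Carrier to A)

  E : Set c
  E = Ext A

  data _≈E_ : E → E → Set (c ⊔ ℓ) where
    bot≈ : bot ≈E bot
    top≈ : top ≈E top
    el≈  : ∀ {a b} → a ≈ b → el a ≈E el b

  data _≤E_ : E → E → Set (c ⊔ ℓ) where
    bot≤ : ∀ {x} → bot ≤E x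
    ≤top : ∀ {x} → x ≤E top
    el≤  : ∀ {a b} → a ≈ b → el a ≤E el b

  _·_ : E → E → E
  bot  · y    = bot
  top  · bot  = bot
  top  · top  = top
  top  · el b = top
  el a · bot  = bot
  el a · top  = top
  el a · el b = el (a ∙ b)

  one : E
  one = el ε

  Meet : E → E → E → Set (c ⊔ ℓ)
  Meet x y z = (z ≤E x) × (z ≤E y) × (∀ w → w ≤E x → w ≤E y → w ≤E z)

  Join : E → E → E → Set (c ⊔ ℓ)
  Join x y z = (x ≤E z) × (y ≤E z) × (∀ w → x ≤E w → y ≤E w → z ≤E w)

  Imp : E → E → E → Set (c ⊔ ℓ)
  Imp x y z = ((x · z) ≤E y) × (∀ b → (x · b) ≤E y → b ≤E z)

  Bang : E → E → Set (c ⊔ ℓ)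
  Bang x z = Meet x one z

data Sym : Set where
  0s ⊥s ⊤s !s : Sym

Subset : Set
Subset = Sym → Bool

module _ {c₁ ℓ₁ c₂ ℓ₂} (G : AbelianGroup c₁ ℓ₁) (H : AbelianGroup c₂ ℓ₂) where
  private
    module G = R G
    module H = R H

  PreservesSym : (G.E → H.E) → Sym → Set (c₁ ⊔ ℓ₁ ⊔ c₂ ⊔ ℓ₂)
  PreservesSym f 0s = Lift (c₁ ⊔ ℓ₁) (f G.one H.≈E H.one)        -- 0 := 1
  PreservesSym f ⊥s = Lift (c₁ ⊔ ℓ₁) (f bot H.≈E bot)
  PreservesSym f ⊤s = Lift (c₁ ⊔ ℓ₁) (f top H.≈E top)
  PreservesSym f !s = ∀ x z → G.Bang x z → H.Bang (f x) (f z)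

  record IsEmbedding (S : Subset) (f : G.E → H.E) : Set (c₁ ⊔ ℓ₁ ⊔ c₂ ⊔ ℓ₂) where
    field
      cong      : ∀ {x y} → x G.≈E y → f x H.≈E f y
      injective : ∀ {x y} → f x H.≈E f y → x G.≈E y
      ∧-homo    : ∀ x y z → G.Meet x y z → H.Meet (f x) (f y) (f z)
      ∨-homo    : ∀ x y z → G.Join x y z → H.Join (f x) (f y) (f z)
      ·-homo    : ∀ x y → f (x G.· y) H.≈E (f x H.· f y)
      →-homo    : ∀ x y z → G.Imp x y z → H.Imp (f x) (f y) (f z)
      1-homo    : f G.one H.≈E H.one
      S-homo    : ∀ s → S s ≡ true → PreservesSym f s

  IsGroupEmbedding : (AbelianGroup.Carrier G → AbelianGroup.Carrier H) → Set (c₁ ⊔ ℓ₁ ⊔ ℓ₂)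
  IsGroupEmbedding = MS.GroupMorphisms.IsGroupMonomorphism
                       (AbelianGroup.rawGroup G) (AbelianGroup.rawGroup H)

  Extends : (G.E → H.E) → (AbelianGroup.Carrier G → AbelianGroup.Carrier H) → Set (c₁ ⊔ c₂ ⊔ ℓ₂)
  Extends β α = ∀ a → β (el a) H.≈E el (α a)

-- An embedding β of R^S(G) into R^S(H) is monotone (it preserves meets) and preserves 1, so
-- β ⊥ ≤ 1 and β ⊤ ≥ 1; injectivity then forces β ⊥ = ⊥ and β ⊤ = ⊤. Elements of G are units
-- of R(G), and units of R(H) lie in H, so β maps G into H, and there it is a group embedding.
-- Conversely, extending a group embedding α by ⊥ ↦ ⊥, ⊤ ↦ ⊤ gives an embedding: every bound
-- in R(H) witnessing the meet, join or residual of image elements can be replaced by the image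
-- of a bound in R(G). For meets and joins this uses injectivity of α; for residuals the only
-- non-trivial bound is some c ∈ H with α a · c = α d, and then c = α (a⁻¹ d).
module Submission where

open import Defs
open import Level using (lift)
open import Data.Product using (Σ; _×_; _,_; proj₁; proj₂)
open import Data.Sum using (_⊎_; inj₁; inj₂)
open import Relation.Binary.PropositionalEquality using (_≡_; refl)
open import Algebra.Bundles using (AbelianGroup; Group)
open import Algebra.Morphism.Structures using (module GroupMorphisms)
import Algebra.Properties.Group as GroupProperties

Ext-map : ∀ {a b} {A : Set a} {B : Set b} → (A → B) → Ext A → Ext B
Ext-map f bot    = bot
Ext-map f top    = top
Ext-map f (el a) = el (f a)

module ExtProperties {c ℓ} (K : AbelianGroup c ℓ) where
  open AbelianGroup K renaming (refl to ≈-refl)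
  open R K

  ≈E-refl : ∀ {x} → x ≈E x
  ≈E-refl {bot}  = bot≈
  ≈E-refl {top}  = top≈
  ≈E-refl {el a} = el≈ ≈-refl

  ≈E-reflexive : ∀ {x y} → x ≡ y → x ≈E y
  ≈E-reflexive refl = ≈E-refl

  ≈E-sym : ∀ {x y} → x ≈E y → y ≈E x
  ≈E-sym bot≈     = bot≈
  ≈E-sym top≈     = top≈
  ≈E-sym (el≈ p)  = el≈ (sym p)

  ≈E-trans : ∀ {x y z} → x ≈E y → y ≈E z → x ≈E z
  ≈E-trans bot≈    bot≈    = bot≈
  ≈E-trans top≈    top≈    = top≈
  ≈E-trans (el≈ p) (el≈ q) = el≈ (trans p q)

  el-injective : ∀ {a b} → el a ≈E el b → a ≈ b
  el-injective (el≈ p) = p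

  ≤E-refl : ∀ {x} → x ≤E x
  ≤E-refl {bot}  = bot≤
  ≤E-refl {top}  = ≤top
  ≤E-refl {el a} = el≤ ≈-refl

  ≤E-trans : ∀ {x y z} → x ≤E y → y ≤E z → x ≤E z
  ≤E-trans bot≤    _       = bot≤
  ≤E-trans _       ≤top    = ≤top
  ≤E-trans (el≤ p) (el≤ q) = el≤ (trans p q)

  ≤E-respˡ-≈E : ∀ {x x′ y} → x ≈E x′ → x ≤E y → x′ ≤E y
  ≤E-respˡ-≈E bot≈    _       = bot≤
  ≤E-respˡ-≈E _       ≤top    = ≤top
  ≤E-respˡ-≈E (el≈ p) (el≤ q) = el≤ (trans (sym p) q)

  ≤E-respʳ-≈E : ∀ {x y y′} → y ≈E y′ → x ≤E y → x ≤E y′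
  ≤E-respʳ-≈E _       bot≤    = bot≤
  ≤E-respʳ-≈E top≈    ≤top    = ≤top
  ≤E-respʳ-≈E (el≈ p) (el≤ q) = el≤ (trans q p)

  ·-cong : ∀ {x x′ y y′} → x ≈E x′ → y ≈E y′ → (x · y) ≈E (x′ · y′)
  ·-cong bot≈    _       = bot≈
  ·-cong top≈    bot≈    = bot≈
  ·-cong top≈    top≈    = top≈
  ·-cong top≈    (el≈ _) = top≈
  ·-cong (el≈ _) bot≈    = bot≈
  ·-cong (el≈ _) top≈    = top≈
  ·-cong (el≈ p) (el≈ q) = el≈ (∙-cong p q)

  ·-zeroʳ : ∀ x → (x · bot) ≈E bot
  ·-zeroʳ bot    = bot≈
  ·-zeroʳ top    = bot≈
  ·-zeroʳ (el _) = bot≈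

  Meet-respʳ-≈E : ∀ {x y y′ z} → y ≈E y′ → Meet x y z → Meet x y′ z
  Meet-respʳ-≈E e (z≤x , z≤y , glb) =
    z≤x , ≤E-respʳ-≈E e z≤y , λ w w≤x w≤y′ → glb w w≤x (≤E-respʳ-≈E (≈E-sym e) w≤y′)

  ≤E⇒Meet : ∀ {x y} → x ≤E y → Meet x y x
  ≤E⇒Meet x≤y = ≤E-refl , x≤y , λ _ w≤x _ → w≤x

  ≤one⇒bot⊎≈one : ∀ {x} → x ≤E one → x ≡ bot ⊎ x ≈E one
  ≤one⇒bot⊎≈one bot≤    = inj₁ refl
  ≤one⇒bot⊎≈one (el≤ p) = inj₂ (el≈ p)

  one≤⇒top⊎≈one : ∀ {x} → one ≤E x → x ≡ top ⊎ x ≈E one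
  one≤⇒top⊎≈one ≤top    = inj₁ refl
  one≤⇒top⊎≈one (el≤ p) = inj₂ (el≈ (sym p))

  unit⇒el : ∀ x y → (x · y) ≈E one → Σ Carrier λ a → x ≡ el a
  unit⇒el bot    _      ()
  unit⇒el top    bot    ()
  unit⇒el top    top    ()
  unit⇒el top    (el _) ()
  unit⇒el (el a) _      _  = a , refl

module _ {c₁ ℓ₁ c₂ ℓ₂} (G : AbelianGroup c₁ ℓ₁) (H : AbelianGroup c₂ ℓ₂) where
  private
    module G = Group (AbelianGroup.group G)
    module H = Group (AbelianGroup.group H)
    module GP = GroupProperties (AbelianGroup.group G)
    module HP = GroupProperties (AbelianGroup.group H)
    module RG = R G
    module RH = R H
    module EG = ExtProperties G
    module EH = ExtProperties H
    open RH using (_≈E_; _≤E_; bot≈; top≈; el≈; bot≤; ≤top; el≤)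

  module Embedding {S : Subset} {β : RG.E → RH.E} (emb : IsEmbedding G H S β) where
    open IsEmbedding emb

    monotone : ∀ {x y} → x RG.≤E y → β x ≤E β y
    monotone x≤y = proj₁ (proj₂ (∧-homo _ _ _ (EG.≤E⇒Meet x≤y)))

    β-bot : β bot ≡ bot
    β-bot with EH.≤one⇒bot⊎≈one (EH.≤E-respʳ-≈E 1-homo (monotone (RG.bot≤ {RG.one})))
    ... | inj₁ β⊥≡⊥ = β⊥≡⊥
    ... | inj₂ β⊥≈1 with injective (EH.≈E-trans β⊥≈1 (EH.≈E-sym 1-homo))
    ... | ()

    β-top : β top ≡ top
    β-top with EH.one≤⇒top⊎≈one (EH.≤E-respˡ-≈E 1-homo (monotone (RG.≤top {RG.one})))
    ... | inj₁ β⊤≡⊤ = β⊤≡⊤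
    ... | inj₂ β⊤≈1 with injective (EH.≈E-trans β⊤≈1 (EH.≈E-sym 1-homo))
    ... | ()

    ≈Ext-map : ∀ {α} → Extends G H β α → ∀ x → β x ≈E Ext-map α x
    ≈Ext-map _   bot    = EH.≈E-reflexive β-bot
    ≈Ext-map _   top    = EH.≈E-reflexive β-top
    ≈Ext-map ext (el a) = ext a

    β-el-unit : ∀ a → (β (el a) RH.· β (el (a G.⁻¹))) ≈E RH.one
    β-el-unit a = EH.≈E-trans (EH.≈E-sym (·-homo (el a) (el (a G.⁻¹))))
                  (EH.≈E-trans (cong (RG.el≈ (G.inverseʳ a))) 1-homo)

    restriction : G.Carrier → H.Carrier
    restriction a = proj₁ (EH.unit⇒el _ _ (β-el-unit a))

    extends-restriction : Extends G H β restriction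
    extends-restriction a = EH.≈E-reflexive (proj₂ (EH.unit⇒el _ _ (β-el-unit a)))

    restriction-isGroupEmbedding : ∀ {α} → Extends G H β α → IsGroupEmbedding G H α
    restriction-isGroupEmbedding {α} ext = record
      { isGroupHomomorphism = record
        { isMonoidHomomorphism = record
          { isMagmaHomomorphism = record
            { isRelHomomorphism = record { cong = α-cong }
            ; homo = α-homo }
          ; ε-homo = α-ε }
        ; ⁻¹-homo = α-⁻¹ }
      ; injective = α-injective }
      where
      through-β : ∀ {a b} → β (el a) ≈E β (el b) → α a H.≈ α b
      through-β {a} {b} p = EH.el-injective (EH.≈E-trans (EH.≈E-sym (ext a)) (EH.≈E-trans p (ext b)))

      α-cong : ∀ {a b} → a G.≈ b → α a H.≈ α b
      α-cong a≈b = through-β (cong (RG.el≈ a≈b))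

      α-homo : ∀ a b → α (a G.∙ b) H.≈ α a H.∙ α b
      α-homo a b = EH.el-injective
        (EH.≈E-trans (EH.≈E-sym (ext (a G.∙ b)))
          (EH.≈E-trans (·-homo (el a) (el b)) (EH.·-cong (ext a) (ext b))))

      α-ε : α G.ε H.≈ H.ε
      α-ε = EH.el-injective (EH.≈E-trans (EH.≈E-sym (ext G.ε)) 1-homo)

      α-⁻¹ : ∀ a → α (a G.⁻¹) H.≈ α a H.⁻¹
      α-⁻¹ a = HP.inverseʳ-unique (α a) (α (a G.⁻¹))
        (H.trans (H.sym (α-homo a (a G.⁻¹))) (H.trans (α-cong (G.inverseʳ a)) α-ε))

      α-injective : ∀ {a b} → α a H.≈ α b → a G.≈ b
      α-injective {a} {b} p = EG.el-injective
        (injective (EH.≈E-trans (ext a) (EH.≈E-trans (el≈ p) (EH.≈E-sym (ext b)))))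

  module ExtendedMonomorphism {α : G.Carrier → H.Carrier} (mono : IsGroupEmbedding G H α) where
    private
      module α = GroupMorphisms.IsGroupMonomorphism mono
      β = Ext-map α

    β-cong : ∀ {x y} → x RG.≈E y → β x ≈E β y
    β-cong RG.bot≈    = bot≈
    β-cong RG.top≈    = top≈
    β-cong (RG.el≈ p) = el≈ (α.⟦⟧-cong p)

    β-injective : ∀ {x y} → β x ≈E β y → x RG.≈E y
    β-injective {bot}  {bot}  _       = RG.bot≈
    β-injective {top}  {top}  _       = RG.top≈
    β-injective {el _} {el _} (el≈ p) = RG.el≈ (α.injective p)
    β-injective {bot}  {top}  ()
    β-injective {bot}  {el _} ()
    β-injective {top}  {bot}  ()
    β-injective {top}  {el _} ()
    β-injective {el _} {bot}  ()
    β-injective {el _} {top}  ()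

    β-· : ∀ x y → β (x RG.· y) ≈E (β x RH.· β y)
    β-· bot    _      = bot≈
    β-· top    bot    = bot≈
    β-· top    top    = top≈
    β-· top    (el _) = top≈
    β-· (el _) bot    = bot≈
    β-· (el _) top    = top≈
    β-· (el a) (el b) = el≈ (α.∙-homo a b)

    β-one : β RG.one ≈E RH.one
    β-one = el≈ α.ε-homo

    β-monotone : ∀ {x y} → x RG.≤E y → β x ≤E β y
    β-monotone RG.bot≤ = bot≤
    β-monotone RG.≤top = ≤top
    β-monotone (RG.el≤ p) = el≤ (α.⟦⟧-cong p)

    el≤β⇒el≤ : ∀ {a c y} → c H.≈ α a → el c ≤E β y → el a RG.≤E y
    el≤β⇒el≤ {y = top}  _    _         = RG.≤top
    el≤β⇒el≤ {y = el b} c≈αa (el≤ c≈αb) = RG.el≤ (α.injective (H.trans (H.sym c≈αa) c≈αb))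

    β≤el⇒≤el : ∀ {a c y} → α a H.≈ c → β y ≤E el c → y RG.≤E el a
    β≤el⇒≤el {y = bot}  _    _         = RG.bot≤
    β≤el⇒≤el {y = el b} αa≈c (el≤ αb≈c) = RG.el≤ (α.injective (H.trans αb≈c (H.sym αa≈c)))

    common-lower-bound : ∀ x y w → w ≤E β x → w ≤E β y →
                         Σ RG.E λ w′ → w′ RG.≤E x × w′ RG.≤E y × w ≤E β w′
    common-lower-bound _      _      bot    _          _          = bot , RG.bot≤ , RG.bot≤ , bot≤
    common-lower-bound top    top    _      _          _          = top , RG.≤top , RG.≤top , ≤top
    common-lower-bound (el a) y      (el c) (el≤ c≈αa) c≤βy       =
      el a , EG.≤E-refl , el≤β⇒el≤ c≈αa c≤βy , el≤ c≈αa
    common-lower-bound top    (el b) (el c) _          (el≤ c≈αb) =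
      el b , RG.≤top , EG.≤E-refl , el≤ c≈αb
    common-lower-bound bot    _      (el _) ()         _
    common-lower-bound bot    _      top    ()         _
    common-lower-bound (el _) _      top    ()         _
    common-lower-bound top    bot    (el _) _          ()
    common-lower-bound top    bot    top    _          ()
    common-lower-bound top    (el _) top    _          ()

    common-upper-bound : ∀ x y w → β x ≤E w → β y ≤E w →
                         Σ RG.E λ w′ → x RG.≤E w′ × y RG.≤E w′ × β w′ ≤E w
    common-upper-bound _      _      top    _          _          = top , RG.≤top , RG.≤top , ≤top
    common-upper-bound bot    bot    _      _          _          = bot , RG.bot≤ , RG.bot≤ , bot≤
    common-upper-bound (el a) y      (el c) (el≤ αa≈c) βy≤c       =
      el a , EG.≤E-refl , β≤el⇒≤el αa≈c βy≤c , el≤ αa≈c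
    common-upper-bound bot    (el b) (el c) _          (el≤ αb≈c) =
      el b , RG.bot≤ , EG.≤E-refl , el≤ αb≈c
    common-upper-bound top    _      (el _) ()         _
    common-upper-bound top    _      bot    ()         _
    common-upper-bound (el _) _      bot    ()         _
    common-upper-bound bot    top    (el _) _          ()
    common-upper-bound bot    top    bot    _          ()
    common-upper-bound bot    (el _) bot    _          ()

    residual-bound : ∀ x y b → (β x RH.· b) ≤E β y →
                     Σ RG.E λ b′ → (x RG.· b′) RG.≤E y × b ≤E β b′
    residual-bound _      _      bot    _             = bot , EG.≤E-respˡ-≈E (EG.≈E-sym (EG.·-zeroʳ _)) RG.bot≤ , bot≤
    residual-bound bot    _      _      _             = top , RG.bot≤ , ≤top
    residual-bound _      top    _      _             = top , RG.≤top , ≤top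
    residual-bound (el a) (el d) (el c) (el≤ αa∙c≈αd) =
      el (a G.\\ d) , RG.el≤ (GP.\\-leftDividesˡ a d) , el≤ c≈α[a\\d]
      where
      c≈α[a\\d] : c H.≈ α (a G.\\ d)
      c≈α[a\\d] = H.trans (H.sym (HP.\\-leftDividesʳ (α a) c))
        (H.trans (H.∙-cong (H.sym (α.⁻¹-homo a)) αa∙c≈αd) (H.sym (α.∙-homo (a G.⁻¹) d)))
    residual-bound top    bot    top    ()
    residual-bound top    bot    (el _) ()
    residual-bound top    (el _) top    ()
    residual-bound top    (el _) (el _) ()
    residual-bound (el _) bot    top    ()
    residual-bound (el _) bot    (el _) ()
    residual-bound (el _) (el _) top    ()

    β-∧ : ∀ x y z → RG.Meet x y z → RH.Meet (β x) (β y) (β z)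
    β-∧ x y z (z≤x , z≤y , glb) = β-monotone z≤x , β-monotone z≤y , λ w w≤βx w≤βy →
      let w′ , w′≤x , w′≤y , w≤βw′ = common-lower-bound x y w w≤βx w≤βy
      in EH.≤E-trans w≤βw′ (β-monotone (glb w′ w′≤x w′≤y))

    β-∨ : ∀ x y z → RG.Join x y z → RH.Join (β x) (β y) (β z)
    β-∨ x y z (x≤z , y≤z , lub) = β-monotone x≤z , β-monotone y≤z , λ w βx≤w βy≤w →
      let w′ , x≤w′ , y≤w′ , βw′≤w = common-upper-bound x y w βx≤w βy≤w
      in EH.≤E-trans (β-monotone (lub w′ x≤w′ y≤w′)) βw′≤w

    β-→ : ∀ x y z → RG.Imp x y z → RH.Imp (β x) (β y) (β z)
    β-→ x y z (xz≤y , greatest) = EH.≤E-respˡ-≈E (β-· x z) (β-monotone xz≤y) , λ b βx·b≤βy →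
      let b′ , xb′≤y , b≤βb′ = residual-bound x y b βx·b≤βy
      in EH.≤E-trans b≤βb′ (β-monotone (greatest b′ xb′≤y))

    isEmbedding : ∀ S → IsEmbedding G H S β
    isEmbedding S = record
      { cong      = β-cong
      ; injective = β-injective
      ; ∧-homo    = β-∧
      ; ∨-homo    = β-∨
      ; ·-homo    = β-·
      ; →-homo    = β-→
      ; 1-homo    = β-one
      ; S-homo    = λ where
          0s _ → lift β-one
          ⊥s _ → lift bot≈
          ⊤s _ → lift top≈
          !s _ → λ x z x∧1≈z → EH.Meet-respʳ-≈E β-one (β-∧ x RG.one z x∧1≈z)
      }

lemma3p7 : ∀ {c₁ ℓ₁ c₂ ℓ₂} (G : AbelianGroup c₁ ℓ₁) (H : AbelianGroup c₂ ℓ₂) (S : Subset) →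
    ((α : AbelianGroup.Carrier G → AbelianGroup.Carrier H) → IsGroupEmbedding G H α →
      Σ (Ext (AbelianGroup.Carrier G) → Ext (AbelianGroup.Carrier H)) (λ β →
        (IsEmbedding G H S β × Extends G H β α)
        × (∀ β′ → IsEmbedding G H S β′ → Extends G H β′ α →
             ∀ x → R._≈E_ H (β′ x) (β x))))
    × ((β : Ext (AbelianGroup.Carrier G) → Ext (AbelianGroup.Carrier H)) → IsEmbedding G H S β →
      Σ (AbelianGroup.Carrier G → AbelianGroup.Carrier H) (λ α →
        IsGroupEmbedding G H α × Extends G H β α))
lemma3p7 G H S =
    (λ α mono → Ext-map α , (isEmbedding mono S , λ _ → ExtProperties.≈E-refl H)
                          , λ _ emb′ ext′ → ≈Ext-map emb′ ext′)
  , λ β emb → restriction emb , restriction-isGroupEmbedding emb (extends-restriction emb)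
                              , extends-restriction emb
  where
  open ExtendedMonomorphism G H
  open Embedding G H
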